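{- Let $X$ be a finite nonempty set of positive integers, $R\in\mathrm{RAT}^+(X)$, $\tau=\zeta(R)$, and $i,j\in X$ with $i<j$. Then $R$ has a cell $(i,j)$ (a tile lying in both strips $i$ and $j$) if and only if $(i,j)$ is a shape-inversion of $\tau$.
   Context: Rhombic diagrams and RAT. Let $X=\{a_1<\cdots<a_n\}$. For $w=w_1\cdots w_n\in\{0,1,2\}^n$, the rhombic diagram $\Gamma_w$ is the region between the southeast border (reading $w$ left to right: a unit step south for $2$, southwest (vector $(-1,-1)$) for $1$, west for $0$) and the northwest border from the same start ((number of $0$'s) steps west, then (number of $1$'s) southwest, then (number of $2$'s) south), tiled by squares, tall rhombi (two vertical, two diagonal sides) and short rhombi (two horizontal, two diagonal sides) via the maximal tiling (if no $i$ has $w_i>w_{i+1}$ nothing is tiled; otherwise for the smallest such $i$, tile the region of the word with $w_i,w_{i+1}$ swapped and add a tall rhombus, square or short rhombus according as $(w_i,w_{i+1})=(2,1),(2,0),(1,0)$). Each tile has N, S, E, W sides (square: obvious; short rhombus: N, S horizontal, W, E diagonal; tall rhombus: N, S diagonal, W, E vertical). The southeast border edges are labeled $a_1,\dots,a_n$ from northeast to southwest; each starts a strip (maximal sequence of tiles connected through parallel edges, ending at the northwest border, possibly empty) with its label: rows from vertical edges, columns from horizontal edges, diagonal strips from diagonal edges. A RAT is a filling of some tiles with up-arrows (only in tiles of a column) and left-arrows (only in tiles of a row) such that no arrow lies in a cell pointed to by another arrow; a left-arrow points to all other cells of its row to its west, an up-arrow to all other cells of its column to its north. A free cell is an empty cell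 pointed to by no arrow. $\mathrm{RAT}^+(X)$ is the set of RAT labeled by $X$ whose first border step is diagonal and in which every column contains an up-arrow. The map $\zeta$. A tile is a turning cell if it is a free cell or contains an up-arrow, a straight cell otherwise. The zigzag path from strip $i$ enters through the northwest border edge at the end of strip $i$, passes through straight cells from N to S or W to E, through turning cells from N to E or W to S, and exits through a southeast border edge labeled $j$. $\zeta(R)=\tau$ with $\tau(i)=-j$ if strip $i$ is diagonal, $\tau(i)=j$ otherwise, $\tau(-i)=-\tau(i)$. Shape-inversions. For a signed permutation $\tau$ on $X$, its shape is $w_1\cdots w_n$ with $w_k=2$ if $\tau(a_k)\ge a_k$, $w_k=1$ if $\tau(a_k)<0$, $w_k=0$ if $0<\tau(a_k)<a_k$. A shape-inversion is a pair $(a_k,a_l)$ with $k<l$ and $w_k>w_l$. -}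

module Defs where

open import Data.Nat using (ℕ; zero; suc; _*_; _<ᵇ_)
open import Data.Fin using (Fin; zero; suc) renaming (_<_ to _<ᶠ_)
open import Data.Fin.Properties using (any?; all?) renaming (_≟_ to _≟ᶠ_; _<?_ to _<?ᶠ_)
open import Data.List using (List; []; _∷_; length; lookup; tabulate; allFin; reverse)
open import Data.Maybe using (Maybe; just; nothing)
open import Data.Product using (Σ; _×_; _,_)
open import Data.Sum using (_⊎_)
open import Data.Bool using (true; false; if_then_else_)
open import Data.Integer using (ℤ; +_; -_; 0ℤ) renaming (_≤_ to _≤ℤ_; _<_ to _<ℤ_)
open import Data.Integer.Properties using () renaming (_≤?_ to _≤?ℤ_; _<?_ to _<?ℤ_)
open import Relation.Binary.PropositionalEquality using (_≡_; refl)
open import Relation.Nullary using (¬_; Dec; yes; no; ¬?; _×-dec_; _⊎-dec_)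

-- Letters of a word in {0,1,2}^n.
-- L0 = unit step west (horizontal edge), L1 = southwest (diagonal edge),
-- L2 = south (vertical edge).

data Letter : Set where
  L0 L1 L2 : Letter

rank : Letter → ℕ
rank L0 = 0
rank L1 = 1
rank L2 = 2

_≟L_ : (x y : Letter) → Dec (x ≡ y)
L0 ≟L L0 = yes refl
L0 ≟L L1 = no λ ()
L0 ≟L L2 = no λ ()
L1 ≟L L0 = no λ ()
L1 ≟L L1 = yes refl
L1 ≟L L2 = no λ ()
L2 ≟L L0 = no λ ()
L2 ≟L L1 = no λ ()
L2 ≟L L2 = yes refl

-- A word w = w_1 ⋯ w_n; position k (0-based Fin index) carries the
-- southeast border edge labelled a_{k+1}, so strips are named by Fin n.
Word : ℕ → Set
Word n = Fin n → Letter

-- Maximal tiling, computed as in the paper: repeatedly take the smallest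
-- descent w_i > w_{i+1} of the current southeast border, put a tile in
-- that corner and swap the two letters.  The tile created by swapping the
-- letters (c , d) (c > d) at positions i, i+1 has
--   * E side = the edge at position i (letter c), W side opposite it:
--     strip `eastLab` passes through the tile from E to W;
--   * S side = the edge at position i+1 (letter d), N side opposite it:
--     strip `southLab` passes through the tile from S to N.
-- (square: (2,0); tall rhombus: (2,1); short rhombus: (1,0).)
-- Tiles are listed in creation order; along each strip this is the order
-- from the southeast border towards the northwest border.

record Tile (n : ℕ) : Set where
  constructor tile
  field
    eastLab  : Fin n
    eastLet  : Letter
    southLab : Fin n
    southLet : Letter
open Tile public

State : ℕ → Set
State n = List (Letter × Fin n)

consState : ∀ {n} → Letter × Fin n → Maybe (Tile n × State n) → Maybe (Tile n × State n)
consState x nothing = nothing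
consState x (just (t , r)) = just (t , x ∷ r)

step : ∀ {n} → State n → Maybe (Tile n × State n)
step [] = nothing
step (x ∷ []) = nothing
step ((c , i) ∷ (d , j) ∷ rest) =
  if rank d <ᵇ rank c
  then just (tile i c j d , (d , j) ∷ (c , i) ∷ rest)
  else consState (c , i) (step ((d , j) ∷ rest))

run : ∀ {n} → ℕ → State n → List (Tile n)
run zero s = []
run (suc f) s with step s
... | nothing = []
... | just (t , s′) = t ∷ run f s′

initial : ∀ {n} → Word n → State n
initial w = tabulate (λ k → (w k , k))

-- Each swap removes exactly one inversion, and there are < n * n
-- inversions, so fuel n * n is enough for the process to terminate.
tiles : ∀ {n} → Word n → List (Tile n)
tiles {n} w = run (n * n) (initial w)

InStrip : ∀ {n} → Fin n → Tile n → Set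
InStrip ℓ t = eastLab t ≡ ℓ ⊎ southLab t ≡ ℓ

inStrip? : ∀ {n} (ℓ : Fin n) (t : Tile n) → Dec (InStrip ℓ t)
inStrip? ℓ t = (eastLab t ≟ᶠ ℓ) ⊎-dec (southLab t ≟ᶠ ℓ)

data Content : Set where
  empty upArrow leftArrow : Content

_≟C_ : (x y : Content) → Dec (x ≡ y)
empty ≟C empty = yes refl
empty ≟C upArrow = no λ ()
empty ≟C leftArrow = no λ ()
upArrow ≟C empty = no λ ()
upArrow ≟C upArrow = yes refl
upArrow ≟C leftArrow = no λ ()
leftArrow ≟C empty = no λ ()
leftArrow ≟C upArrow = no λ ()
leftArrow ≟C leftArrow = yes refl

module Diagram {n : ℕ} (w : Word n) where

  Cell : Set
  Cell = Fin (length (tiles w))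

  tileAt : Cell → Tile n
  tileAt = lookup (tiles w)

  InRow : Cell → Set
  InRow c = Σ (Fin n) λ ℓ → w ℓ ≡ L2 × InStrip ℓ (tileAt c)

  InColumn : Cell → Set
  InColumn c = Σ (Fin n) λ ℓ → w ℓ ≡ L0 × InStrip ℓ (tileAt c)

  Filling : Set
  Filling = Cell → Content

  -- p points to q: a left-arrow in p points to the other cells of its row
  -- west of p (= later along the row); an up-arrow in p points to the
  -- other cells of its column north of p (= later along the column).
  PointsTo : Filling → Cell → Cell → Set
  PointsTo F p q =
      (F p ≡ leftArrow × (Σ (Fin n) λ ℓ → w ℓ ≡ L2 × InStrip ℓ (tileAt p) × InStrip ℓ (tileAt q)) × p <ᶠ q)
    ⊎ (F p ≡ upArrow × (Σ (Fin n) λ ℓ → w ℓ ≡ L0 × InStrip ℓ (tileAt p) × InStrip ℓ (tileAt q)) × p <ᶠ q)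

  pointsTo? : (F : Filling) (p q : Cell) → Dec (PointsTo F p q)
  pointsTo? F p q =
      ((F p ≟C leftArrow) ×-dec (any? (λ ℓ → (w ℓ ≟L L2) ×-dec (inStrip? ℓ (tileAt p) ×-dec inStrip? ℓ (tileAt q)))) ×-dec (p <?ᶠ q))
    ⊎-dec ((F p ≟C upArrow) ×-dec (any? (λ ℓ → (w ℓ ≟L L0) ×-dec (inStrip? ℓ (tileAt p) ×-dec inStrip? ℓ (tileAt q)))) ×-dec (p <?ᶠ q))

  IsRAT : Filling → Set
  IsRAT F = (∀ c → F c ≡ upArrow → InColumn c)
          × (∀ c → F c ≡ leftArrow → InRow c)
          × (∀ p q → PointsTo F p q → F q ≡ empty)

  Free : Filling → Cell → Set
  Free F c = F c ≡ empty × (∀ p → ¬ PointsTo F p c)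

  Turning : Filling → Cell → Set
  Turning F c = Free F c ⊎ F c ≡ upArrow

  turning? : (F : Filling) (c : Cell) → Dec (Turning F c)
  turning? F c = ((F c ≟C empty) ×-dec all? (λ p → ¬? (pointsTo? F p c))) ⊎-dec (F c ≟C upArrow)

  -- One step of a zigzag path, walking backwards (towards the southeast)
  -- along strip ℓ through cell c: straight cells keep the strip,
  -- turning cells switch to the other strip of the cell (N→E or W→S).
  move : Filling → Cell → Fin n → Fin n
  move F c ℓ with eastLab (tileAt c) ≟ᶠ ℓ | southLab (tileAt c) ≟ᶠ ℓ | turning? F c
  ... | yes _ | _     | yes _ = southLab (tileAt c)
  ... | no _  | yes _ | yes _ = eastLab (tileAt c)
  ... | _     | _     | _     = ℓ

  follow : Filling → List Cell → Fin n → Fin n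
  follow F [] ℓ = ℓ
  follow F (c ∷ cs) ℓ = follow F cs (move F c ℓ)

  -- zigzag path entering at the northwest end of strip ℓ; returns the
  -- label of the southeast border edge where it exits
  zigzag : Filling → Fin n → Fin n
  zigzag F ℓ = follow F (reverse (allFin (length (tiles w)))) ℓ

open Diagram public

-- RAT and RAT⁺ (labels a_1 < ⋯ < a_n are attached to positions; the
-- combinatorial data only uses the positions)

record RAT (n : ℕ) : Set where
  field
    word  : Word n
    fill  : Filling word
    isRAT : IsRAT word fill
open RAT public

record RAT⁺ (m : ℕ) : Set where
  field
    rat        : RAT (suc m)
    firstDiag  : word rat zero ≡ L1
    columnsUp  : ∀ ℓ → word rat ℓ ≡ L0 →
                 Σ (Cell (word rat)) λ c → InStrip ℓ (tileAt (word rat) c) × fill rat c ≡ upArrow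
open RAT⁺ public

-- ζ(R) as a signed map on X = {a k}: τ(a_ℓ) = ∓ a_j
ζ : ∀ {m} → (Fin (suc m) → ℕ) → RAT⁺ m → Fin (suc m) → ℤ
ζ a R ℓ with word (rat R) ℓ ≟L L1
... | yes _ = - (+ a (zigzag (word (rat R)) (fill (rat R)) ℓ))
... | no _  = + a (zigzag (word (rat R)) (fill (rat R)) ℓ)

HasCell : ∀ {m} → RAT⁺ m → Fin (suc m) → Fin (suc m) → Set
HasCell R k l = Σ (Cell (word (rat R))) λ c →
  InStrip k (tileAt (word (rat R)) c) × InStrip l (tileAt (word (rat R)) c)

shape : ∀ {n} → (Fin n → ℕ) → (Fin n → ℤ) → Fin n → Letter
shape a τ k with (+ a k) ≤?ℤ τ k
... | yes _ = L2
... | no _ with τ k <?ℤ 0ℤ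
...   | yes _ = L1
...   | no _  = L0

ShapeInversion : ∀ {n} → (Fin n → ℕ) → (Fin n → ℤ) → Fin n → Fin n → Set
ShapeInversion a τ k l = k <ᶠ l × rank (shape a τ l) Data.Nat.< rank (shape a τ k)

{-# OPTIONS --safe #-}
-- The maximal tiling is a bubble sort of the border word: every tile records the swap of an
-- adjacent descent of the current border, its east strip being the one that moves southwest.
-- The order of two strips on the border is reversed only by their own swap, which requires them
-- to form a descent, and the final border is sorted.  Hence the tiles are exactly the pairs of
-- strips k < l with w l < w k.
--
-- It remains to see that ζ(R) has shape w.  Diagonal strips get negative values since a > 0.
-- For the others, follow the zigzag path backwards through the swap history: a path entering
-- on row k always lies on a strip at or after k on the current border, and a path entering on
-- column k lies on a strip at or before k, and strictly before k once the swap that created the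
-- up-arrow cell of that column has been undone.  On the initial border this order is the order
-- of X.
module Submission where

open import Defs
open import Algebra.Properties.CommutativeSemigroup using (x∙yz≈y∙xz)
open import Data.Bool using (Bool; true; false; T; if_then_else_)
open import Data.Empty using (⊥-elim)
open import Data.Fin using (Fin; zero; suc; toℕ) renaming (_<_ to _<ᶠ_)
import Data.Fin.Properties as Fin
open import Data.Fin.Properties using (<⇒≢) renaming (_≟_ to _≟ᶠ_)
open import Data.Integer using (ℤ; +_; -_; 0ℤ; +≤+; +<+)
  renaming (_≤_ to _≤ℤ_; _<_ to _<ℤ_)
import Data.Integer.Properties as ℤ
open import Data.Integer.Properties using () renaming (_≤?_ to _≤?ℤ_; _<?_ to _<?ℤ_)
open import Data.List
  using (List; []; _∷_; length; map; foldr; foldl; tabulate; allFin; reverse)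
open import Data.List.Properties using (length-tabulate; map-tabulate; tabulate-lookup; foldl-ʳ++)
open import Data.List.Membership.Propositional.Properties using (∈-lookup; ∈-allFin)
open import Data.List.Relation.Unary.All as All using (All; []; _∷_)
import Data.List.Relation.Unary.All.Properties as Allₚ
open import Data.List.Relation.Unary.AllPairs using (AllPairs; []; _∷_)
open import Data.List.Relation.Unary.Any as Any using (Any; here; there; index)
import Data.List.Relation.Unary.Any.Properties as Anyₚ
open import Data.List.Relation.Unary.Any.Properties using (lookup-index)
open import Data.List.Relation.Unary.Linked using (Linked; []; [-]; _∷_)
open import Data.List.Relation.Unary.Linked.Properties using (Linked⇒AllPairs)
open import Data.Maybe using (just; nothing)
open import Data.Nat
  using (ℕ; zero; suc; _+_; _*_; _<_; _≤_; z≤n; s≤s; z<s; s<s; s≤s⁻¹; _<ᵇ_)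
open import Data.Nat.Properties
  using ( <ᵇ⇒<; <⇒<ᵇ; +-suc; ≮⇒≥; <-irrefl; <-asym; <⇒≤; <⇒≱; n≮0; ≤-reflexive; ≤-trans
        ; n≤1+n; m≤n⇒m≤1+n; +-mono-≤; *-monoʳ-≤; +-commutativeSemigroup)
open import Data.Product using (Σ; ∃-syntax; _×_; _,_; proj₁; proj₂; uncurry)
open import Data.Sum using (_⊎_; inj₁; inj₂; map₁; map₂; [_,_]′)
open import Function using (_∘_; id)
open import Function.Bundles using (_⇔_; mk⇔)
open import Relation.Binary.Core using (_Preserves_⟶_)
open import Relation.Binary.PropositionalEquality
  using (_≡_; _≢_; refl; sym; trans; cong; subst; subst₂; module ≡-Reasoning)
open import Relation.Nullary using (¬_; yes; no; contradiction)
open import Relation.Nullary.Decidable using (isYes; isYes≗does; dec-true)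

open ≡-Reasoning

private variable
  n : ℕ
  a b k l x : Fin n
  s s′ s″ : State n
  t : Tile n
  ts : List (Tile n)

-- Borders and swaps

data _∈ˢ_ (l : Fin n) : State n → Set where
  here  : ∀ {y s} → l ∈ˢ ((y , l) ∷ s)
  there : ∀ {e s} → l ∈ˢ s → l ∈ˢ (e ∷ s)

data Precedes (a b : Fin n) : State n → Set where
  here  : ∀ {y s} → b ∈ˢ s → Precedes a b ((y , a) ∷ s)
  there : ∀ {e s} → Precedes a b s → Precedes a b (e ∷ s)

AtOrBefore : Fin n → Fin n → State n → Set
AtOrBefore a b s = a ≡ b ⊎ Precedes a b s

data Distinct {n} : State n → Set where
  []  : Distinct []
  _∷_ : ∀ {y l s} → ¬ l ∈ˢ s → Distinct s → Distinct ((y , l) ∷ s)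

Precedes⇒∈ˢ₁ : Precedes a b s → a ∈ˢ s
Precedes⇒∈ˢ₁ (here _)  = here
Precedes⇒∈ˢ₁ (there p) = there (Precedes⇒∈ˢ₁ p)

Precedes⇒∈ˢ₂ : Precedes a b s → b ∈ˢ s
Precedes⇒∈ˢ₂ (here b∈) = there b∈
Precedes⇒∈ˢ₂ (there p) = there (Precedes⇒∈ˢ₂ p)

lookup-∈ˢ : ∀ {P : Letter × Fin n → Set} → All P s → l ∈ˢ s → ∃[ y ] P (y , l)
lookup-∈ˢ (p ∷ _)  here      = _ , p
lookup-∈ˢ (_ ∷ ps) (there m) = lookup-∈ˢ ps m

data Swap {n} : State n → Tile n → State n → Set where
  swap : ∀ {c i d j r} → rank d < rank c →
         Swap ((c , i) ∷ (d , j) ∷ r) (tile i c j d) ((d , j) ∷ (c , i) ∷ r)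
  skip : ∀ {e s t s′} → Swap s t s′ → Swap (e ∷ s) t (e ∷ s′)

step⇒Swap : ∀ s → step s ≡ just (t , s′) → Swap s t s′
step⇒Swap ((c , i) ∷ (d , j) ∷ r) eq with rank d <ᵇ rank c in desc
step⇒Swap ((c , i) ∷ (d , j) ∷ r) refl | true =
  swap (<ᵇ⇒< (rank d) (rank c) (subst T (sym desc) _))
step⇒Swap ((c , i) ∷ (d , j) ∷ r) eq   | false with step ((d , j) ∷ r) in eq′
step⇒Swap ((c , i) ∷ (d , j) ∷ r) refl | false | just _ = skip (step⇒Swap ((d , j) ∷ r) eq′)

∈ˢ-Swap⁻ : Swap s t s′ → l ∈ˢ s′ → l ∈ˢ s
∈ˢ-Swap⁻ (swap _) here              = there here
∈ˢ-Swap⁻ (swap _) (there here)      = here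
∈ˢ-Swap⁻ (swap _) (there (there m)) = there (there m)
∈ˢ-Swap⁻ (skip v) here              = here
∈ˢ-Swap⁻ (skip v) (there m)         = there (∈ˢ-Swap⁻ v m)

∈ˢ-Swap⁺ : Swap s t s′ → l ∈ˢ s → l ∈ˢ s′
∈ˢ-Swap⁺ (swap _) here              = there here
∈ˢ-Swap⁺ (swap _) (there here)      = here
∈ˢ-Swap⁺ (swap _) (there (there m)) = there (there m)
∈ˢ-Swap⁺ (skip v) here              = here
∈ˢ-Swap⁺ (skip v) (there m)         = there (∈ˢ-Swap⁺ v m)

Swap-east∈ˢ : Swap s t s′ → eastLab t ∈ˢ s
Swap-east∈ˢ (swap _) = here
Swap-east∈ˢ (skip v) = there (Swap-east∈ˢ v)

Swap-south∈ˢ : Swap s t s′ → southLab t ∈ˢ s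
Swap-south∈ˢ (swap _) = there here
Swap-south∈ˢ (skip v) = there (Swap-south∈ˢ v)

Swap-precedes : Swap s t s′ → Precedes (eastLab t) (southLab t) s
Swap-precedes (swap _) = here here
Swap-precedes (skip v) = there (Swap-precedes v)

Distinct-Swap : Swap s t s′ → Distinct s → Distinct s′
Distinct-Swap (swap _) (i∉ ∷ j∉ ∷ d) =
  (λ { here → i∉ here ; (there m) → j∉ m }) ∷ (i∉ ∘ there) ∷ d
Distinct-Swap (skip v) (y∉ ∷ d) = (y∉ ∘ ∈ˢ-Swap⁻ v) ∷ Distinct-Swap v d

Precedes-Swap⁻ : Swap s t s′ → Precedes a b s′ →
                 Precedes a b s ⊎ (a ≡ southLab t × b ≡ eastLab t)
Precedes-Swap⁻ (swap _) (here here)       = inj₂ (refl , refl)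
Precedes-Swap⁻ (swap _) (here (there m))  = inj₁ (there (here m))
Precedes-Swap⁻ (swap _) (there (here m))  = inj₁ (here (there m))
Precedes-Swap⁻ (swap _) (there (there p)) = inj₁ (there (there p))
Precedes-Swap⁻ (skip v) (here m)          = inj₁ (here (∈ˢ-Swap⁻ v m))
Precedes-Swap⁻ (skip v) (there p)         = map₁ there (Precedes-Swap⁻ v p)

Precedes-Swap⁺ : Swap s t s′ → Precedes a b s →
                 (eastLab t ≡ a × southLab t ≡ b) ⊎ Precedes a b s′
Precedes-Swap⁺ (swap _) (here here)       = inj₁ (refl , refl)
Precedes-Swap⁺ (swap _) (here (there m))  = inj₂ (there (here m))
Precedes-Swap⁺ (swap _) (there (here m))  = inj₂ (here (there m))
Precedes-Swap⁺ (swap _) (there (there p)) = inj₂ (there (there p))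
Precedes-Swap⁺ (skip v) (here m)          = inj₂ (here (∈ˢ-Swap⁺ v m))
Precedes-Swap⁺ (skip v) (there p)         = map₂ there (Precedes-Swap⁺ v p)

Precedes-Swap⁻ˡ : Swap s t s′ → southLab t ≢ a → Precedes a b s′ → Precedes a b s
Precedes-Swap⁻ˡ v s≢a p with Precedes-Swap⁻ v p
... | inj₁ p′         = p′
... | inj₂ (a≡s , _) = contradiction (sym a≡s) s≢a

Precedes-Swap⁻ʳ : Swap s t s′ → eastLab t ≢ b → Precedes a b s′ → Precedes a b s
Precedes-Swap⁻ʳ v e≢b p with Precedes-Swap⁻ v p
... | inj₁ p′         = p′
... | inj₂ (_ , b≡e) = contradiction (sym b≡e) e≢b

-- After the swap, southLab t and eastLab t are adjacent in s′, in this order.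

≺east⇒≺south : Swap s t s′ → Distinct s → Precedes x (eastLab t) s′ → x ≢ southLab t →
               Precedes x (southLab t) s′
≺east⇒≺south (swap _) _        (here _)          x≢j = contradiction refl x≢j
≺east⇒≺south (swap _) (i∉ ∷ _) (there (here m))  _   = contradiction (there m) i∉
≺east⇒≺south (swap _) (i∉ ∷ _) (there (there p)) _   = contradiction (there (Precedes⇒∈ˢ₂ p)) i∉
≺east⇒≺south (skip v) _        (here _)          _   = here (∈ˢ-Swap⁺ v (Swap-south∈ˢ v))
≺east⇒≺south (skip v) (_ ∷ d)  (there p)         x≢s = there (≺east⇒≺south v d p x≢s)

≺south⇒≺east : Swap s t s′ → Distinct s → Precedes x (southLab t) s′ →
               Precedes x (eastLab t) s′
≺south⇒≺east (swap _) _            (here _)          = here here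
≺south⇒≺east (swap _) (_ ∷ j∉ ∷ _) (there (here m))  = contradiction m j∉
≺south⇒≺east (swap _) (_ ∷ j∉ ∷ _) (there (there p)) = contradiction (Precedes⇒∈ˢ₂ p) j∉
≺south⇒≺east (skip v) _            (here _)          = here (∈ˢ-Swap⁺ v (Swap-east∈ˢ v))
≺south⇒≺east (skip v) (_ ∷ d)      (there p)         = there (≺south⇒≺east v d p)

east≺⇒south≺ : Swap s t s′ → Distinct s → Precedes (eastLab t) x s′ →
               Precedes (southLab t) x s′
east≺⇒south≺ (swap _) _        (here m)  = here m
east≺⇒south≺ (swap _) _        (there p) = here (Precedes⇒∈ˢ₂ p)
east≺⇒south≺ (skip v) (y∉ ∷ _) (here _)  = contradiction (Swap-east∈ˢ v) y∉
east≺⇒south≺ (skip v) (_ ∷ d)  (there p) = there (east≺⇒south≺ v d p)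

south≺⇒east≺ : Swap s t s′ → Distinct s → Precedes (southLab t) x s′ → x ≢ eastLab t →
               Precedes (eastLab t) x s′
south≺⇒east≺ (swap _) _            (here here)       x≢i = contradiction refl x≢i
south≺⇒east≺ (swap _) _            (here (there m))  _   = there (here m)
south≺⇒east≺ (swap _) (i∉ ∷ _)     (there (here _))  _   = contradiction here i∉
south≺⇒east≺ (swap _) (_ ∷ j∉ ∷ _) (there (there p)) _   = contradiction (Precedes⇒∈ˢ₁ p) j∉
south≺⇒east≺ (skip v) (y∉ ∷ _)     (here _)          _   = contradiction (Swap-south∈ˢ v) y∉
south≺⇒east≺ (skip v) (_ ∷ d)      (there p)         x≢e = there (south≺⇒east≺ v d p x≢e)

-- Termination

data Run {n} : State n → List (Tile n) → State n → Set where
  []  : ∀ {s} → Run s [] s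
  _∷_ : ∀ {s t s′ ts s″} → Swap s t s′ → Run s′ ts s″ → Run s (t ∷ ts) s″

Run-Precedes : Run s ts s′ → Precedes a b s →
               Any (λ t → eastLab t ≡ a × southLab t ≡ b) ts ⊎ Precedes a b s′
Run-Precedes []      p = inj₂ p
Run-Precedes (v ∷ r) p with Precedes-Swap⁺ v p
... | inj₁ tile-ab = inj₁ (here tile-ab)
... | inj₂ p′      = map₁ there (Run-Precedes r p′)

below : Letter → State n → ℕ
below c []            = 0
below c ((d , _) ∷ s) = if rank d <ᵇ rank c then suc (below c s) else below c s

inversions : State n → ℕ
inversions []            = 0
inversions ((c , _) ∷ s) = below c s + inversions s

below-Swap : ∀ c → Swap s t s′ → below c s′ ≡ below c s
below-Swap c (swap {c = d} {d = e} _) with rank d <ᵇ rank c | rank e <ᵇ rank c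
... | true  | true  = refl
... | true  | false = refl
... | false | true  = refl
... | false | false = refl
below-Swap c (skip {e = (d , _)} v) =
  cong (λ m → if rank d <ᵇ rank c then suc m else m) (below-Swap c v)

inversions-Swap : Swap s t s′ → inversions s ≡ suc (inversions s′)
inversions-Swap (swap {c} {d = d} {r = r} d<c)
  with rank d <ᵇ rank c in d<ᵇc | rank c <ᵇ rank d in c<ᵇd
... | true  | false = cong suc (x∙yz≈y∙xz +-commutativeSemigroup (below c r) (below d r) (inversions r))
... | false | _     = ⊥-elim (subst T d<ᵇc (<⇒<ᵇ d<c))
... | true  | true  = contradiction (<ᵇ⇒< (rank c) (rank d) (subst T (sym c<ᵇd) _)) (<-asym d<c)
inversions-Swap (skip {e = (c , _)} {s} {s′ = s′} v)
  rewrite inversions-Swap v | below-Swap c v = +-suc (below c s) (inversions s′)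

below≤length : ∀ c (s : State n) → below c s ≤ length s
below≤length c []            = z≤n
below≤length c ((d , _) ∷ s) with rank d <ᵇ rank c
... | true  = s≤s (below≤length c s)
... | false = m≤n⇒m≤1+n (below≤length c s)

inversions≤length² : ∀ (s : State n) → inversions s ≤ length s * length s
inversions≤length² []            = z≤n
inversions≤length² ((c , _) ∷ s) =
  ≤-trans (+-mono-≤ (below≤length c s)
                    (≤-trans (inversions≤length² s) (*-monoʳ-≤ (length s) (n≤1+n (length s)))))
          (n≤1+n _)

run-terminates : ∀ f (s : State n) → inversions s ≤ f →
                 ∃[ s′ ] Run s (run f s) s′ × step s′ ≡ nothing
run-terminates zero s bound with step s in eq
... | nothing      = s , [] , eq
... | just (t , _) with () ← subst (_≤ 0) (inversions-Swap (step⇒Swap s eq)) bound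
run-terminates (suc f) s bound with step s in eq
... | nothing       = s , [] , eq
... | just (t , s′)
  with run-terminates f s′ (s≤s⁻¹ (subst (_≤ suc f) (inversions-Swap (step⇒Swap s eq)) bound))
...   | s″ , r , stuck = s″ , step⇒Swap s eq ∷ r , stuck

_≤ʳ_ : Letter × Fin n → Letter × Fin n → Set
e ≤ʳ e′ = rank (proj₁ e) ≤ rank (proj₁ e′)

stuck-head : ∀ {c i d j} {r : State n} → step ((c , i) ∷ (d , j) ∷ r) ≡ nothing →
             rank c ≤ rank d
stuck-head {c = c} {d = d} {j} {r} stuck with rank d <ᵇ rank c in d<ᵇc | step ((d , j) ∷ r)
stuck-head () | true  | _
stuck-head _  | false | nothing = ≮⇒≥ (λ d<c → subst T d<ᵇc (<⇒<ᵇ d<c))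
stuck-head () | false | just _

stuck-tail : ∀ {e} (s : State n) → step (e ∷ s) ≡ nothing → step s ≡ nothing
stuck-tail []            _ = refl
stuck-tail {e = (c , _)} ((d , j) ∷ r) stuck with rank d <ᵇ rank c | step ((d , j) ∷ r)
stuck-tail _ () | true  | _
stuck-tail _ _  | false | nothing = refl
stuck-tail _ () | false | just _

stuck⇒Linked : ∀ (s : State n) → step s ≡ nothing → Linked _≤ʳ_ s
stuck⇒Linked []          _     = []
stuck⇒Linked (_ ∷ [])    _     = [-]
stuck⇒Linked (_ ∷ e ∷ s) stuck =
  stuck-head stuck ∷ stuck⇒Linked (e ∷ s) (stuck-tail (e ∷ s) stuck)

Lettered : Word n → State n → Set
Lettered w = All (λ (x , l) → w l ≡ x)

Descends : Word n → Tile n → Set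
Descends w t = rank (w (southLab t)) < rank (w (eastLab t))

InversionsOrdered : Word n → State n → Set
InversionsOrdered w s = ∀ {a b} → Precedes a b s → rank (w b) < rank (w a) → a <ᶠ b

module _ {w : Word n} where

  Lettered-Swap : Swap s t s′ → Lettered w s → Lettered w s′
  Lettered-Swap (swap _) (wi ∷ wj ∷ ws) = wj ∷ wi ∷ ws
  Lettered-Swap (skip v) (we ∷ ws)      = we ∷ Lettered-Swap v ws

  Swap-descends : Swap s t s′ → Lettered w s → Descends w t
  Swap-descends (swap d<c) (refl ∷ refl ∷ _) = d<c
  Swap-descends (skip v)   (_ ∷ ws)          = Swap-descends v ws

  InversionsOrdered-Swap : Swap s t s′ → Lettered w s →
                           InversionsOrdered w s → InversionsOrdered w s′
  InversionsOrdered-Swap v ws ordered p inv with Precedes-Swap⁻ v p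
  ... | inj₁ p′            = ordered p′ inv
  ... | inj₂ (refl , refl) = contradiction (Swap-descends v ws) (<-asym inv)

  Run-Lettered : Run s ts s′ → Lettered w s → Lettered w s′
  Run-Lettered []      ws = ws
  Run-Lettered (v ∷ r) ws = Run-Lettered r (Lettered-Swap v ws)

  Run-descends : Run s ts s′ → Lettered w s → All (Descends w) ts
  Run-descends []      _  = []
  Run-descends (v ∷ r) ws = Swap-descends v ws ∷ Run-descends r (Lettered-Swap v ws)

  Run-increasing : Run s ts s′ → Lettered w s → InversionsOrdered w s →
                   All (λ t → eastLab t <ᶠ southLab t) ts
  Run-increasing []      _  _       = []
  Run-increasing (v ∷ r) ws ordered =
    ordered (Swap-precedes v) (Swap-descends v ws)
      ∷ Run-increasing r (Lettered-Swap v ws) (InversionsOrdered-Swap v ws ordered)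

  sorted-Precedes : AllPairs _≤ʳ_ s → Lettered w s → Precedes a b s → rank (w a) ≤ rank (w b)
  sorted-Precedes (heads ∷ _) (refl ∷ ws) (here b∈) with lookup-∈ˢ (All.zip (heads , ws)) b∈
  ... | _ , a≤b , refl = a≤b
  sorted-Precedes (_ ∷ sorted) (_ ∷ ws) (there p) = sorted-Precedes sorted ws p

  stuck-Precedes : step s ≡ nothing → Lettered w s → Precedes a b s → rank (w a) ≤ rank (w b)
  stuck-Precedes {s = s} stuck = sorted-Precedes (Linked⇒AllPairs ≤-trans (stuck⇒Linked s stuck))

∈ˢ-tabulate⁺ : ∀ {m} (x : Fin m → Letter) (g : Fin m → Fin n) k →
               g k ∈ˢ tabulate (λ k → (x k , g k))
∈ˢ-tabulate⁺ x g zero    = here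
∈ˢ-tabulate⁺ x g (suc k) = there (∈ˢ-tabulate⁺ (x ∘ suc) (g ∘ suc) k)

∈ˢ-tabulate⁻ : ∀ {m} (x : Fin m → Letter) (g : Fin m → Fin n) →
               l ∈ˢ tabulate (λ k → (x k , g k)) → ∃[ k ] g k ≡ l
∈ˢ-tabulate⁻ {m = suc _} x g here        = zero , refl
∈ˢ-tabulate⁻ {m = suc _} x g (there mem) with ∈ˢ-tabulate⁻ (x ∘ suc) (g ∘ suc) mem
... | k , gk≡l = suc k , gk≡l

Distinct-tabulate : ∀ {m} (x : Fin m → Letter) (g : Fin m → Fin n) →
                    g Preserves _<ᶠ_ ⟶ _<ᶠ_ → Distinct (tabulate (λ k → (x k , g k)))
Distinct-tabulate {m = zero}  x g g-mono = []
Distinct-tabulate {m = suc _} x g g-mono =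
  (λ mem → let k , gk≡g0 = ∈ˢ-tabulate⁻ (x ∘ suc) (g ∘ suc) mem in
           <-irrefl (cong toℕ (sym gk≡g0)) (g-mono z<s))
  ∷ Distinct-tabulate (x ∘ suc) (g ∘ suc) (g-mono ∘ s<s)

Precedes-tabulate⁻ : ∀ {m} (x : Fin m → Letter) (g : Fin m → Fin n) →
                     g Preserves _<ᶠ_ ⟶ _<ᶠ_ →
                     Precedes a b (tabulate (λ k → (x k , g k))) → a <ᶠ b
Precedes-tabulate⁻ {m = suc _} x g g-mono (here mem) with ∈ˢ-tabulate⁻ (x ∘ suc) (g ∘ suc) mem
... | k , refl = g-mono z<s
Precedes-tabulate⁻ {m = suc _} x g g-mono (there p) =
  Precedes-tabulate⁻ (x ∘ suc) (g ∘ suc) (g-mono ∘ s<s) p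

Precedes-tabulate⁺ : ∀ {m} (x : Fin m → Letter) (g : Fin m → Fin n) {i j} → i <ᶠ j →
                     Precedes (g i) (g j) (tabulate (λ k → (x k , g k)))
Precedes-tabulate⁺ x g {zero}  {suc j} _         = here (∈ˢ-tabulate⁺ (x ∘ suc) (g ∘ suc) j)
Precedes-tabulate⁺ x g {suc i} {suc j} (s<s i<j) =
  there (Precedes-tabulate⁺ (x ∘ suc) (g ∘ suc) i<j)

module _ (w : Word n) where

  initial-Distinct : Distinct (initial w)
  initial-Distinct = Distinct-tabulate w id id

  initial-Lettered : Lettered w (initial w)
  initial-Lettered = Allₚ.tabulate⁺ (λ _ → refl)

  initial-Precedes⁻ : Precedes a b (initial w) → a <ᶠ b
  initial-Precedes⁻ = Precedes-tabulate⁻ w id id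

  initial-Precedes⁺ : a <ᶠ b → Precedes a b (initial w)
  initial-Precedes⁺ = Precedes-tabulate⁺ w id

-- Paths through a run

pass : Tile n → Bool → Fin n → Fin n
pass t false ℓ = ℓ
pass t true  ℓ with eastLab t ≟ᶠ ℓ | southLab t ≟ᶠ ℓ
... | yes _ | _     = southLab t
... | no _  | yes _ = eastLab t
... | no _  | no _  = ℓ

-- The tiles are listed in creation order, so the path meets the last one first.
walk : List (Tile n × Bool) → Fin n → Fin n
walk ps ℓ = foldr (uncurry pass) ℓ ps

data Pass (t : Tile n) : Bool → Fin n → Fin n → Set where
  straight   : ∀ {b ℓ} → b ≡ false ⊎ eastLab t ≢ ℓ × southLab t ≢ ℓ → Pass t b ℓ ℓ
  east→south : Pass t true (eastLab t) (southLab t)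
  south→east : Pass t true (southLab t) (eastLab t)

pass-view : ∀ t b (ℓ : Fin n) → Pass t b ℓ (pass t b ℓ)
pass-view t false ℓ = straight (inj₁ refl)
pass-view t true  ℓ with eastLab t ≟ᶠ ℓ | southLab t ≟ᶠ ℓ
... | yes refl | _        = east→south
... | no _     | yes refl = south→east
... | no e≢ℓ   | no s≢ℓ   = straight (inj₂ (e≢ℓ , s≢ℓ))

walk-invariant : ∀ (P : State n → Fin n → Set) {Q : Tile n → Set} →
                 (∀ {s t s′ ℓ} b → Distinct s → Swap s t s′ → Q t → P s′ ℓ → P s (pass t b ℓ)) →
                 ∀ {ps ℓ} → Run s (map proj₁ ps) s′ → Distinct s → All Q (map proj₁ ps) →
                 P s′ ℓ → P s (walk ps ℓ)
walk-invariant P step-P {[]}          []      _ _        p = p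
walk-invariant P step-P {(_ , b) ∷ _} (v ∷ r) d (q ∷ qs) p =
  step-P b d v q (walk-invariant P step-P r (Distinct-Swap v d) qs p)

row-step : ∀ {ℓ} b → Distinct s → Swap s t s′ → southLab t ≢ k →
           AtOrBefore k ℓ s′ → AtOrBefore k (pass t b ℓ) s
row-step {t = t} {ℓ = ℓ} b d v s≢k k≼ℓ with pass t b ℓ | pass-view t b ℓ
... | _ | straight _ = map₂ (Precedes-Swap⁻ˡ v s≢k) k≼ℓ
... | _ | east→south with k≼ℓ
...   | inj₁ refl = inj₂ (Swap-precedes v)
...   | inj₂ p    = inj₂ (Precedes-Swap⁻ˡ v s≢k (≺east⇒≺south v d p (s≢k ∘ sym)))
row-step b d v s≢k k≼ℓ | _ | south→east with k≼ℓ
...   | inj₁ refl = contradiction refl s≢k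
...   | inj₂ p    = inj₂ (Precedes-Swap⁻ˡ v s≢k (≺south⇒≺east v d p))

row-walk : ∀ {ps} → Run s (map proj₁ ps) s′ → Distinct s →
           All (λ t → southLab t ≢ k) (map proj₁ ps) → AtOrBefore k (walk ps k) s
row-walk {k = k} r d s≢k =
  walk-invariant (λ s ℓ → AtOrBefore k ℓ s) row-step r d s≢k (inj₁ refl)

column-step-strict : ∀ {ℓ} b → Distinct s → Swap s t s′ → eastLab t ≢ k →
                     Precedes ℓ k s′ → Precedes (pass t b ℓ) k s
column-step-strict {t = t} {ℓ = ℓ} b d v e≢k p with pass t b ℓ | pass-view t b ℓ
... | _ | straight _ = Precedes-Swap⁻ʳ v e≢k p
... | _ | east→south = Precedes-Swap⁻ʳ v e≢k (east≺⇒south≺ v d p)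
... | _ | south→east = Precedes-Swap⁻ʳ v e≢k (south≺⇒east≺ v d p (e≢k ∘ sym))

column-step : ∀ {ℓ} b → Distinct s → Swap s t s′ → eastLab t ≢ k →
              AtOrBefore ℓ k s′ → AtOrBefore (pass t b ℓ) k s
column-step b d v e≢k (inj₂ p) = inj₂ (column-step-strict b d v e≢k p)
column-step {t = t} {k = k} b d v e≢k (inj₁ refl) with pass t b k | pass-view t b k
... | _ | straight _ = inj₁ refl
... | _ | east→south = contradiction refl e≢k
... | _ | south→east = inj₂ (Swap-precedes v)

column-turn : ∀ {ℓ} → Distinct s → Swap s t s′ → eastLab t ≢ k → southLab t ≡ k →
              AtOrBefore ℓ k s′ → Precedes (pass t true ℓ) k s
column-turn d v e≢k _ (inj₂ p) = column-step-strict true d v e≢k p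
column-turn {t = t} {k = k} d v e≢k s≡k (inj₁ refl) with pass t true k | pass-view t true k
... | _ | straight (inj₁ ())
... | _ | straight (inj₂ (_ , s≢k)) = contradiction s≡k s≢k
... | _ | east→south = contradiction refl e≢k
... | _ | south→east = Swap-precedes v

column-walk : ∀ {ps} → Run s (map proj₁ ps) s′ → Distinct s →
              All (λ t → eastLab t ≢ k) (map proj₁ ps) →
              Any (λ (t , b) → b ≡ true × southLab t ≡ k) ps → Precedes (walk ps k) k s
column-walk {k = k} (v ∷ r) d (e≢k ∷ e≢ks) (here (refl , s≡k)) =
  column-turn d v e≢k s≡k
    (walk-invariant (λ s ℓ → AtOrBefore ℓ k s) column-step r (Distinct-Swap v d) e≢ks (inj₁ refl))
column-walk {ps = (_ , b) ∷ _} (v ∷ r) d (e≢k ∷ e≢ks) (there turn) =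
  column-step-strict b d v e≢k (column-walk r (Distinct-Swap v d) e≢ks turn)

-- The maximal tiling and its zigzag paths

rank≤2 : ∀ x → rank x ≤ 2
rank≤2 L0 = z≤n
rank≤2 L1 = s≤s z≤n
rank≤2 L2 = s≤s (s≤s z≤n)

module _ {w : Word n} where

  south-not-row : w k ≡ L2 → All (Descends w) ts → All (λ t → southLab t ≢ k) ts
  south-not-row wk = All.map λ {t} descends s≡k →
    <⇒≱ (subst (λ x → rank x < rank (w (eastLab t))) (trans (cong w s≡k) wk) descends)
        (rank≤2 (w (eastLab t)))

  east-not-column : w k ≡ L0 → All (Descends w) ts → All (λ t → eastLab t ≢ k) ts
  east-not-column wk = All.map λ {t} descends e≡k →
    n≮0 (subst (λ x → rank (w (southLab t)) < rank x) (trans (cong w e≡k) wk) descends)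

tiles-run : (w : Word n) → ∃[ s ] Run (initial w) (tiles w) s × step s ≡ nothing
tiles-run {n} w = run-terminates (n * n) (initial w)
  (subst (λ L → inversions (initial w) ≤ L * L) (length-tabulate (λ k → (w k , k)))
         (inversions≤length² (initial w)))

module _ (w : Word n) where

  tiles-descend : All (Descends w) (tiles w)
  tiles-descend = let _ , r , _ = tiles-run w in Run-descends r (initial-Lettered w)

  tiles-increasing : All (λ t → eastLab t <ᶠ southLab t) (tiles w)
  tiles-increasing =
    let _ , r , _ = tiles-run w in
    Run-increasing r (initial-Lettered w) (λ p _ → initial-Precedes⁻ w p)

  tiles-cover-inversions : k <ᶠ l → rank (w l) < rank (w k) →
                           Any (λ t → eastLab t ≡ k × southLab t ≡ l) (tiles w)
  tiles-cover-inversions k<l l<k with tiles-run w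
  ... | _ , r , stuck with Run-Precedes r (initial-Precedes⁺ w k<l)
  ...   | inj₁ tile-kl = tile-kl
  ...   | inj₂ p       =
    contradiction (stuck-Precedes stuck (Run-Lettered r (initial-Lettered w)) p) (<⇒≱ l<k)

  cell-strips : ∀ c → k <ᶠ l → InStrip k (tileAt w c) → InStrip l (tileAt w c) →
                eastLab (tileAt w c) ≡ k × southLab (tileAt w c) ≡ l
  cell-strips c k<l (inj₁ e≡k) (inj₁ e≡l) = contradiction (trans (sym e≡k) e≡l) (<⇒≢ k<l)
  cell-strips c k<l (inj₁ e≡k) (inj₂ s≡l) = e≡k , s≡l
  cell-strips c k<l (inj₂ s≡k) (inj₁ e≡l) =
    contradiction (subst₂ _<ᶠ_ e≡l s≡k (All.lookup tiles-increasing (∈-lookup c))) (Fin.<-asym k<l)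
  cell-strips c k<l (inj₂ s≡k) (inj₂ s≡l) = contradiction (trans (sym s≡k) s≡l) (<⇒≢ k<l)

  cell⇒descent : ∀ c → k <ᶠ l → InStrip k (tileAt w c) → InStrip l (tileAt w c) →
                 rank (w l) < rank (w k)
  cell⇒descent c k<l k∈c l∈c with cell-strips c k<l k∈c l∈c
  ... | refl , refl = All.lookup tiles-descend (∈-lookup c)

  descent⇒cell : k <ᶠ l → rank (w l) < rank (w k) →
                 Σ (Cell w) λ c → InStrip k (tileAt w c) × InStrip l (tileAt w c)
  descent⇒cell k<l l<k =
    let tile-kl   = tiles-cover-inversions k<l l<k
        e≡k , s≡l = lookup-index tile-kl
    in index tile-kl , inj₁ e≡k , inj₂ s≡l

module _ (w : Word n) (F : Filling w) where

  -- isYes rather than does: does (turning? w F c) unfolds, which would block the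
  -- with-abstraction in move≡pass.
  mark : Cell w → Tile n × Bool
  mark c = tileAt w c , isYes (turning? w F c)

  markedTiles : List (Tile n × Bool)
  markedTiles = map mark (allFin _)

  map-proj₁-markedTiles : map proj₁ markedTiles ≡ tiles w
  map-proj₁-markedTiles = begin
    map proj₁ (map mark (allFin _))  ≡⟨ cong (map proj₁) (map-tabulate id mark) ⟩
    map proj₁ (tabulate mark)        ≡⟨ map-tabulate mark proj₁ ⟩
    tabulate (tileAt w)              ≡⟨ tabulate-lookup (tiles w) ⟩
    tiles w                          ∎

  move≡pass : ∀ c ℓ → move w F c ℓ ≡ uncurry pass (mark c) ℓ
  move≡pass c ℓ with turning? w F c
  ... | yes _ with eastLab (tileAt w c) ≟ᶠ ℓ | southLab (tileAt w c) ≟ᶠ ℓ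
  ...   | yes _ | _     = refl
  ...   | no _  | yes _ = refl
  ...   | no _  | no _  = refl
  move≡pass c ℓ | no _ with eastLab (tileAt w c) ≟ᶠ ℓ | southLab (tileAt w c) ≟ᶠ ℓ
  ...   | yes _ | _     = refl
  ...   | no _  | yes _ = refl
  ...   | no _  | no _  = refl

  follow≡foldl : ∀ cs ℓ → follow w F cs ℓ ≡ foldl (λ ℓ c → move w F c ℓ) ℓ cs
  follow≡foldl []       ℓ = refl
  follow≡foldl (c ∷ cs) ℓ = follow≡foldl cs (move w F c ℓ)

  foldr-move≡walk : ∀ cs ℓ → foldr (move w F) ℓ cs ≡ walk (map mark cs) ℓ
  foldr-move≡walk []       ℓ = refl
  foldr-move≡walk (c ∷ cs) ℓ =
    trans (move≡pass c _) (cong (uncurry pass (mark c)) (foldr-move≡walk cs ℓ))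

  zigzag≡walk : ∀ ℓ → zigzag w F ℓ ≡ walk markedTiles ℓ
  zigzag≡walk ℓ = begin
    zigzag w F ℓ                          ≡⟨ follow≡foldl (reverse cells) ℓ ⟩
    foldl step-back ℓ (reverse cells)     ≡⟨ foldl-ʳ++ step-back ℓ cells ⟩
    foldr (move w F) ℓ cells              ≡⟨ foldr-move≡walk cells ℓ ⟩
    walk markedTiles ℓ                    ∎
    where
    cells : List (Cell w)
    cells = allFin (length (tiles w))
    step-back : Fin n → Cell w → Fin n
    step-back ℓ c = move w F c ℓ

  markedTiles-run : Run (initial w) (map proj₁ markedTiles) (proj₁ (tiles-run w))
  markedTiles-run =
    subst (λ ts → Run (initial w) ts _) (sym map-proj₁-markedTiles) (proj₁ (proj₂ (tiles-run w)))

  markedTiles-descend : All (Descends w) (map proj₁ markedTiles)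
  markedTiles-descend = subst (All (Descends w)) (sym map-proj₁-markedTiles) (tiles-descend w)

  zigzag-row : w k ≡ L2 → k ≡ zigzag w F k ⊎ k <ᶠ zigzag w F k
  zigzag-row {k = k} wk rewrite zigzag≡walk k =
    map₂ (initial-Precedes⁻ w)
      (row-walk markedTiles-run (initial-Distinct w) (south-not-row wk markedTiles-descend))

  zigzag-column : w k ≡ L0 → ∀ c → InStrip k (tileAt w c) → Turning w F c → zigzag w F k <ᶠ k
  zigzag-column wk c (inj₁ e≡k) _ =
    contradiction e≡k (All.lookup (east-not-column wk (tiles-descend w)) (∈-lookup c))
  zigzag-column {k = k} wk c (inj₂ s≡k) turning rewrite zigzag≡walk k =
    initial-Precedes⁻ w
      (column-walk markedTiles-run (initial-Distinct w) (east-not-column wk markedTiles-descend)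
        (Anyₚ.map⁺ (Any.map (λ { refl → marked-turning , s≡k }) (∈-allFin c))))
    where
    marked-turning : isYes (turning? w F c) ≡ true
    marked-turning = trans (isYes≗does (turning? w F c)) (dec-true (turning? w F c) turning)

-- Shapes

module _ (a : Fin n → ℕ) (τ : Fin n → ℤ) (k : Fin n) where

  shape≡L2 : + a k ≤ℤ τ k → shape a τ k ≡ L2
  shape≡L2 ak≤τk with + a k ≤?ℤ τ k
  ... | yes _    = refl
  ... | no ak≰τk = contradiction ak≤τk ak≰τk

  shape≡L1 : τ k <ℤ 0ℤ → shape a τ k ≡ L1
  shape≡L1 τk<0 with + a k ≤?ℤ τ k
  ... | yes ak≤τk = contradiction (ℤ.≤-<-trans ak≤τk τk<0) λ { (+<+ ()) }
  ... | no _ with τ k <?ℤ 0ℤ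
  ...   | yes _   = refl
  ...   | no τk≮0 = contradiction τk<0 τk≮0

  shape≡L0 : 0ℤ ≤ℤ τ k → τ k <ℤ + a k → shape a τ k ≡ L0
  shape≡L0 0≤τk τk<ak with + a k ≤?ℤ τ k
  ... | yes ak≤τk = contradiction ak≤τk (ℤ.<⇒≱ τk<ak)
  ... | no _ with τ k <?ℤ 0ℤ
  ...   | yes τk<0 = contradiction 0≤τk (ℤ.<⇒≱ τk<0)
  ...   | no _     = refl

module _ {m : ℕ} (a : Fin (suc m) → ℕ) (a-pos : ∀ k → 0 < a k)
         (a-mono : ∀ k l → k <ᶠ l → a k < a l) (R : RAT⁺ m) where

  private
    w : Word (suc m)
    w = word (rat R)
    F : Filling w
    F = fill (rat R)

  a-mono-≤ : k ≡ l ⊎ k <ᶠ l → a k ≤ a l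
  a-mono-≤ = [ ≤-reflexive ∘ cong a , <⇒≤ ∘ a-mono _ _ ]′

  ζ-diagonal : ∀ {ℓ} → w ℓ ≡ L1 → ζ a R ℓ ≡ - + a (zigzag w F ℓ)
  ζ-diagonal {ℓ} wℓ with w ℓ ≟L L1
  ... | yes _    = refl
  ... | no wℓ≢L1 = contradiction wℓ wℓ≢L1

  ζ-nondiagonal : ∀ {ℓ} → w ℓ ≢ L1 → ζ a R ℓ ≡ + a (zigzag w F ℓ)
  ζ-nondiagonal {ℓ} wℓ≢L1 with w ℓ ≟L L1
  ... | yes wℓ = contradiction wℓ wℓ≢L1
  ... | no _   = refl

  shape-ζ : ∀ ℓ → shape a (ζ a R) ℓ ≡ w ℓ
  shape-ζ ℓ = shape-ζ-at (w ℓ) refl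
    where
    shape-ζ-at : ∀ x → w ℓ ≡ x → shape a (ζ a R) ℓ ≡ x
    shape-ζ-at L1 wℓ = shape≡L1 a (ζ a R) ℓ
      (subst (_<ℤ 0ℤ) (sym (ζ-diagonal wℓ)) (ℤ.neg-mono-< (+<+ (a-pos _))))
    shape-ζ-at L2 wℓ = shape≡L2 a (ζ a R) ℓ
      (subst (+ a ℓ ≤ℤ_) (sym (ζ-nondiagonal ((λ ()) ∘ trans (sym wℓ))))
        (+≤+ (a-mono-≤ (zigzag-row w F wℓ))))
    shape-ζ-at L0 wℓ =
      let c , ℓ∈c , up = columnsUp R ℓ wℓ
          ζℓ = sym (ζ-nondiagonal ((λ ()) ∘ trans (sym wℓ)))
      in shape≡L0 a (ζ a R) ℓ
           (subst (0ℤ ≤ℤ_) ζℓ (+≤+ z≤n))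
           (subst (_<ℤ + a ℓ) ζℓ (+<+ (a-mono _ _ (zigzag-column w F wℓ c ℓ∈c (inj₂ up)))))

lemma5p18 : (m : ℕ) (a : Fin (suc m) → ℕ)
    → (∀ k → 0 < a k)
    → (∀ k l → k <ᶠ l → a k < a l)
    → (R : RAT⁺ m)
    → (k l : Fin (suc m)) → k <ᶠ l
    → HasCell R k l ⇔ ShapeInversion a (ζ a R) k l
lemma5p18 m a a-pos a-mono R k l k<l =
  mk⇔ (λ (c , k∈c , l∈c) → k<l , to-shape (cell⇒descent w c k<l k∈c l∈c))
      (λ (_ , l<k) → descent⇒cell w k<l (from-shape l<k))
  where
  w : Word (suc m)
  w = word (rat R)
  rank-shape : ∀ ℓ → rank (shape a (ζ a R) ℓ) ≡ rank (w ℓ)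
  rank-shape ℓ = cong rank (shape-ζ a a-pos a-mono R ℓ)
  to-shape : rank (w l) < rank (w k) → rank (shape a (ζ a R) l) < rank (shape a (ζ a R) k)
  to-shape = subst₂ _<_ (sym (rank-shape l)) (sym (rank-shape k))
  from-shape : rank (shape a (ζ a R) l) < rank (shape a (ζ a R) k) → rank (w l) < rank (w k)
  from-shape = subst₂ _<_ (rank-shape l) (rank-shape k)
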